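{- Let $w$ be a finite word, and let $n$ be the length of the longest rich suffix of $w$ or the length of the longest rich prefix of $w$. Then $\mathrm{D}_\infty(w)\le |w|-n$.
   Context: A palindrome is a word equal to its reversal (the empty word is a palindrome). A finite word $x$ is rich if it has exactly $|x|+1$ distinct palindromic factors (counting the empty word). For a finite word $x$, $\mathrm{Pal}(x)$ is the set of its palindromic factors including the empty word, and $\mathrm{D}(x)=|x|+1-|\mathrm{Pal}(x)|$. For an infinite word $z$, $\mathrm{D}(z)=\sup\{\mathrm{D}(u): u \text{ a finite factor of } z\}$ ($\infty$ if unbounded). The infinite defect of a finite word $w$ is $\mathrm{D}_\infty(w)=\min\{\mathrm{D}(z): z \text{ an infinite (right, left or two-way) word having } w \text{ as a factor},\ \mathrm{Alph}(z)\subseteq\mathrm{Alph}(w)\}$, $\mathrm{Alph}$ being the set of letters occurring. -}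

module Defs where

open import Data.Nat using (ℕ; _+_; _∸_; _≤_; suc)
open import Data.Integer using (ℤ; +_) renaming (_+_ to _+ℤ_)
open import Data.List using (List; length; map; upTo; filter; deduplicate; concatMap; inits; tails; reverse; _++_)
open import Data.List.Properties using (≡-dec)
open import Data.List.Membership.Propositional using (_∈_)
open import Data.Product using (Σ; ∃; _×_)
open import Data.Sum using (_⊎_)
open import Relation.Binary.Definitions using (DecidableEquality)
open import Relation.Binary.PropositionalEquality using (_≡_)

module _ {A : Set} (_≟_ : DecidableEquality A) where

  factors : List A → List (List A)
  factors x = concatMap inits (tails x)

  -- Pal(x): distinct palindromic factors of x (including the empty word)
  Pal : List A → List (List A)
  Pal x = deduplicate (≡-dec _≟_)
            (filter (λ p → ≡-dec _≟_ (reverse p) p) (factors x))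

  -- D(x) = |x| + 1 - |Pal(x)|   (|Pal(x)| ≤ |x|+1 always holds)
  Dfin : List A → ℕ
  Dfin x = suc (length x) ∸ length (Pal x)

  Rich : List A → Set
  Rich x = length (Pal x) ≡ suc (length x)

-- infinite words: right-infinite z0 z1 z2 ..., left-infinite ... z2 z1 z0,
-- two-way ... z(-1) z0 z1 ...
data InfWord (A : Set) : Set where
  right  : (ℕ → A) → InfWord A
  left   : (ℕ → A) → InfWord A
  twoway : (ℤ → A) → InfWord A

module _ {A : Set} where

  segℕ : (ℕ → A) → ℕ → ℕ → List A
  segℕ z i m = map (λ j → z (i + j)) (upTo m)

  segℤ : (ℤ → A) → ℤ → ℕ → List A
  segℤ z i m = map (λ j → z (i +ℤ + j)) (upTo m)

  Factor : List A → InfWord A → Set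
  Factor u (right z)  = ∃ λ i → segℕ z i (length u) ≡ u
  Factor u (left z)   = ∃ λ i → reverse (segℕ z i (length u)) ≡ u
  Factor u (twoway z) = ∃ λ i → segℤ z i (length u) ≡ u

  Occurs : A → InfWord A → Set
  Occurs a (right z)  = ∃ λ i → z i ≡ a
  Occurs a (left z)   = ∃ λ i → z i ≡ a
  Occurs a (twoway z) = ∃ λ i → z i ≡ a

  AlphSub : InfWord A → List A → Set
  AlphSub z w = ∀ a → Occurs a z → a ∈ w

  IsSuffix IsPrefix : List A → List A → Set
  IsSuffix s w = ∃ λ t → t ++ s ≡ w
  IsPrefix p w = ∃ λ t → p ++ t ≡ w

module _ {A : Set} (_≟_ : DecidableEquality A) where

  DinfWordLe : InfWord A → ℕ → Set
  DinfWordLe z k = ∀ u → Factor u z → Dfin _≟_ u ≤ k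

  -- D_∞(w) ≤ k : the minimum over admissible infinite words z of D(z)
  -- (a value in ℕ ∪ {∞}) is ≤ k, i.e. some admissible z has D(z) ≤ k
  DinftyLe : List A → ℕ → Set
  DinftyLe w k = Σ (InfWord A) λ z → Factor w z × AlphSub z w × DinfWordLe z k

  LongestRichSuffixLength : List A → ℕ → Set
  LongestRichSuffixLength w n =
    (∃ λ s → IsSuffix s w × Rich _≟_ s × length s ≡ n)
    × (∀ s → IsSuffix s w → Rich _≟_ s → length s ≤ n)

  LongestRichPrefixLength : List A → ℕ → Set
  LongestRichPrefixLength w n =
    (∃ λ p → IsPrefix p w × Rich _≟_ p × length p ≡ n)
    × (∀ p → IsPrefix p w → Rich _≟_ p → length p ≤ n)

-- Every nonempty rich word x extends to a rich word x c with c a letter of x. Write x = v b r with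
-- r the palindromic suffix of x occurring only once in x; then b r b is a new palindrome of x b.
-- If x itself is a palindrome, take for r instead its longest proper palindromic suffix q: the
-- unioccurrent palindromic suffixes of the rich prefixes of x show that q occurs in x only as a
-- prefix and as a suffix, which again makes b q b new. Iterating from a rich suffix s of w = t s
-- gives a right-infinite word t s c₀ c₁ … over the letters of w whose prefixes are t followed by a
-- rich word; since a letter adds at most one new palindrome, each factor has defect at most |t|.
-- Rich prefixes reduce to rich suffixes by reversal, producing a left-infinite word.
module Submission where

open import Defs
open import Data.Nat using (ℕ; zero; suc; _+_; _∸_; _≤_; _<_; z≤n; s≤s; z<s; s<s)
open import Data.Nat.Properties
open import Data.List
  using (List; []; _∷_; _++_; _∷ʳ_; [_]; length; reverse; filter; inits; applyUpTo; take; drop; initLast; _∷ʳ′_)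
open import Data.List.Properties
open import Data.List.Membership.Propositional using (_∈_; find; lose)
open import Data.List.Membership.Propositional.Properties
open import Data.List.Relation.Binary.Subset.Propositional using (_⊆_)
open import Data.List.Relation.Unary.Any using (here; there; any?)
open import Data.List.Relation.Unary.Any.Properties using (reverse⁻)
open import Data.List.Relation.Unary.All using (_∷_)
import Data.List.Relation.Unary.All as All
open import Data.List.Relation.Unary.AllPairs using (_∷_)
open import Data.List.Relation.Unary.Unique.Propositional using (Unique)
open import Data.Product using (∃; ∃₂; _×_; _,_; proj₁; proj₂)
open import Data.Sum using (_⊎_; inj₁; inj₂)
open import Data.Empty using (⊥; ⊥-elim)
open import Function using (_∘_; flip)
open import Relation.Nullary using (¬_; Dec; yes; no; ¬?)
open import Relation.Nullary.Decidable using (map′)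
import Data.List.Membership.DecPropositional as DM
import Data.List.Relation.Unary.Unique.DecPropositional.Properties as UDP
import Data.List.Relation.Unary.Unique.Propositional.Properties as UP
open import Relation.Unary using (Decidable)
open import Induction.WellFounded using (Acc; acc)
open import Data.Nat.Induction using (<-wellFounded)
open import Relation.Binary.Definitions using (DecidableEquality)
open import Relation.Binary.PropositionalEquality hiding ([_])
open import Data.Nat.Tactic.RingSolver using (solve-∀)

module _ {B : Set} where

  Unique-⊆⇒length≤ : {L M : List B} → Unique L → L ⊆ M → length L ≤ length M
  Unique-⊆⇒length≤ {[]} _ _ = z≤n
  Unique-⊆⇒length≤ {x ∷ L} (x∉L ∷ L!) L⊆M with ∈-∃++ (L⊆M (here refl))
  ... | ys , zs , refl = begin
      suc (length L)             ≤⟨ s≤s (Unique-⊆⇒length≤ L! L⊆ys++zs) ⟩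
      suc (length (ys ++ zs))    ≡⟨ length-++-sucʳ ys x zs ⟨
      length (ys ++ x ∷ zs)      ∎
    where
    open ≤-Reasoning
    L⊆ys++zs : L ⊆ ys ++ zs
    L⊆ys++zs {u} u∈L with ∈-++⁻ ys (L⊆M (there u∈L))
    ... | inj₁ u∈ys           = ∈-++⁺ˡ u∈ys
    ... | inj₂ (here refl)    = ⊥-elim (All.lookup x∉L u∈L refl)
    ... | inj₂ (there u∈zs)   = ∈-++⁺ʳ ys u∈zs

  Unique-constant⇒length≤1 : {L : List B} → Unique L →
    (∀ {u v} → u ∈ L → v ∈ L → u ≡ v) → length L ≤ 1
  Unique-constant⇒length≤1 {[]}        _                  _ = z≤n
  Unique-constant⇒length≤1 {_ ∷ []}    _                  _ = s≤s z≤n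
  Unique-constant⇒length≤1 {_ ∷ _ ∷ _} ((x≢y ∷ _) ∷ _) const =
    ⊥-elim (x≢y (const (here refl) (there (here refl))))

least-witness : {P : ℕ → Set} → Decidable P → ∀ {n} → P n →
  ∃ λ k → P k × (∀ {j} → j < k → ¬ P j)
least-witness P? {zero} p0 = 0 , p0 , λ ()
least-witness P? {suc n} pn with P? 0
... | yes p0 = 0 , p0 , λ ()
... | no ¬p0 with least-witness (λ j → P? (suc j)) pn
...   | k , pk , below = suc k , pk , λ { {zero} _ → ¬p0 ; {suc j} (s≤s j<k) → below j<k }

module _ {A : Set} where

  ++-equidivisible : ∀ (a u a′ u′ : List A) → a ++ u ≡ a′ ++ u′ →
    (∃ λ d → a′ ≡ a ++ d × u ≡ d ++ u′) ⊎ (∃ λ d → a ≡ a′ ++ d × u′ ≡ d ++ u)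
  ++-equidivisible []      u []       u′ eq = inj₁ ([] , refl , eq)
  ++-equidivisible []      u (y ∷ a′) u′ eq = inj₁ (y ∷ a′ , refl , eq)
  ++-equidivisible (x ∷ a) u []       u′ eq = inj₂ (x ∷ a , refl , sym eq)
  ++-equidivisible (x ∷ a) u (y ∷ a′) u′ eq with ∷-injective eq
  ... | refl , eq′ with ++-equidivisible a u a′ u′ eq′
  ...   | inj₁ (d , a′≡ , u≡) = inj₁ (d , cong (x ∷_) a′≡ , u≡)
  ...   | inj₂ (d , a≡ , u′≡) = inj₂ (d , cong (x ∷_) a≡ , u′≡)

  drop-length-++ : ∀ (xs ys : List A) → drop (length xs) (xs ++ ys) ≡ ys
  drop-length-++ []       ys = refl
  drop-length-++ (_ ∷ xs) ys = drop-length-++ xs ys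

  length-∷ʳ : ∀ (x : List A) c → length (x ∷ʳ c) ≡ suc (length x)
  length-∷ʳ x c = trans (length-++ x) (+-comm (length x) 1)

  length-++-<ˡ : ∀ (xs : List A) {ys} → ys ≢ [] → length xs < length (xs ++ ys)
  length-++-<ˡ xs {[]}     ys≢[] = ⊥-elim (ys≢[] refl)
  length-++-<ˡ xs {y ∷ ys} _     = ≤-trans (s≤s (length-++-≤ˡ xs)) (≤-reflexive (sym (length-++-sucʳ xs y ys)))

  length-++-<ʳ : ∀ {xs} (ys : List A) → xs ≢ [] → length ys < length (xs ++ ys)
  length-++-<ʳ {[]}    ys xs≢[] = ⊥-elim (xs≢[] refl)
  length-++-<ʳ {_ ∷ xs} ys _    = s≤s (length-++-≤ʳ ys {xs})

  shorter-prefix : ∀ {u y x : List A} → IsPrefix u x → IsPrefix y x → length u < length y →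
    ∃ λ e → y ≡ u ++ e × e ≢ []
  shorter-prefix {u} {y} (s , us≡x) (t , yt≡x) u<y with ++-equidivisible u s y t (trans us≡x (sym yt≡x))
  ... | inj₁ (e , y≡ue , _) = e , y≡ue , λ e≡[] →
    <-irrefl refl (subst (λ z → length u < length z) (trans y≡ue (trans (cong (u ++_) e≡[]) (++-identityʳ u))) u<y)
  ... | inj₂ (d , u≡yd , _) =
    ⊥-elim (<⇒≱ u<y (subst (λ z → length y ≤ length z) (sym u≡yd) (length-++-≤ˡ y)))

  length-∸-suffix : ∀ (t s : List A) {w} → t ++ s ≡ w → length w ∸ length s ≡ length t
  length-∸-suffix t s refl = trans (cong (_∸ length s) (length-++ t)) (m+n∸n≡m (length t) (length s))

  length-∸-prefix : ∀ (p t : List A) {w} → p ++ t ≡ w → length w ∸ length p ≡ length t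
  length-∸-prefix p t refl = trans (cong (_∸ length p) (length-++ p)) (m+n∸m≡n (length p) (length t))

  IsFactor : List A → List A → Set
  IsFactor u x = ∃₂ λ a b → a ++ u ++ b ≡ x

  factor-trans : ∀ {u v x} → IsFactor u v → IsFactor v x → IsFactor u x
  factor-trans {u} (a , b , refl) (a′ , b′ , refl) = a′ ++ a , b ++ b′ , (begin
      (a′ ++ a) ++ u ++ b ++ b′    ≡⟨ ++-assoc a′ a _ ⟩
      a′ ++ a ++ u ++ b ++ b′      ≡⟨ cong (λ t → a′ ++ a ++ t) (++-assoc u b b′) ⟨
      a′ ++ a ++ (u ++ b) ++ b′    ≡⟨ cong (a′ ++_) (++-assoc a (u ++ b) b′) ⟨
      a′ ++ (a ++ u ++ b) ++ b′    ∎)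
    where open ≡-Reasoning

  factor-reverse : ∀ {u x} → IsFactor u x → IsFactor (reverse u) (reverse x)
  factor-reverse {u} (a , b , refl) = reverse b , reverse a , (begin
      reverse b ++ reverse u ++ reverse a   ≡⟨ ++-assoc (reverse b) (reverse u) (reverse a) ⟨
      (reverse b ++ reverse u) ++ reverse a ≡⟨ cong (_++ reverse a) (reverse-++ u b) ⟨
      reverse (u ++ b) ++ reverse a         ≡⟨ reverse-++ a (u ++ b) ⟨
      reverse (a ++ u ++ b)                 ∎)
    where open ≡-Reasoning

  prefix-trans : ∀ {u v x : List A} → IsPrefix u v → IsPrefix v x → IsPrefix u x
  prefix-trans {u} (r , refl) (r′ , refl) = r ++ r′ , sym (++-assoc u r r′)

  prefix⇒factor : ∀ {u x} → IsPrefix u x → IsFactor u x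
  prefix⇒factor (b , eq) = [] , b , eq

  suffix⇒factor : ∀ {u x} → IsSuffix u x → IsFactor u x
  suffix⇒factor {u} (a , eq) = a , [] , trans (cong (a ++_) (++-identityʳ u)) eq

  factor-++ʳ : ∀ {u x} y → IsFactor u x → IsFactor u (x ++ y)
  factor-++ʳ y f = factor-trans f (prefix⇒factor (y , refl))

  factor-∷ʳ⁻ : ∀ {u x c} a b → a ++ u ++ b ≡ x ∷ʳ c → b ≢ [] → IsFactor u x
  factor-∷ʳ⁻ {u} {x} {c} a b eq b≢[] with initLast b
  ... | []        = ⊥-elim (b≢[] refl)
  ... | b′ ∷ʳ′ c′ = a , b′ , ∷ʳ-injectiveˡ (a ++ u ++ b′) x (begin
      (a ++ u ++ b′) ∷ʳ c′   ≡⟨ ++-assoc a (u ++ b′) [ c′ ] ⟩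
      a ++ (u ++ b′) ∷ʳ c′   ≡⟨ cong (a ++_) (++-assoc u b′ [ c′ ]) ⟩
      a ++ u ++ b′ ∷ʳ c′     ≡⟨ eq ⟩
      x ∷ʳ c                 ∎)
    where open ≡-Reasoning

  newFactor⇒suffix : ∀ {u x c} → IsFactor u (x ∷ʳ c) → ¬ IsFactor u x → IsSuffix u (x ∷ʳ c)
  newFactor⇒suffix {u} (a , [] , eq) _ = a , trans (cong (a ++_) (sym (++-identityʳ u))) eq
  newFactor⇒suffix (a , b@(_ ∷ _) , eq) new = ⊥-elim (new (factor-∷ʳ⁻ a b eq λ ()))

  OccursOnlyAsSuffix : List A → List A → Set
  OccursOnlyAsSuffix r y = ∀ a b → a ++ r ++ b ≡ y → b ≡ []

  Palindrome : List A → Set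
  Palindrome p = reverse p ≡ p

  palindromic-suffix-is-prefix : ∀ d {v} → Palindrome (d ++ v) → Palindrome v → d ++ v ≡ v ++ reverse d
  palindromic-suffix-is-prefix d {v} pal-dv pal-v =
    trans (sym pal-dv) (trans (reverse-++ d v) (cong (_++ reverse d) pal-v))

  palindromic-prefix-is-suffix : ∀ {v} d → Palindrome (v ++ d) → Palindrome v → v ++ d ≡ reverse d ++ v
  palindromic-prefix-is-suffix {v} d pal-vd pal-v =
    trans (sym pal-vd) (trans (reverse-++ v d) (cong (reverse d ++_) pal-v))

  palindrome-wrap : ∀ b {r} → Palindrome r → Palindrome (b ∷ r ∷ʳ b)
  palindrome-wrap b {r} pal = begin
      reverse (b ∷ r ∷ʳ b)     ≡⟨ unfold-reverse b (r ∷ʳ b) ⟩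
      reverse (r ∷ʳ b) ∷ʳ b    ≡⟨ cong (_∷ʳ b) (reverse-++ r [ b ]) ⟩
      b ∷ reverse r ∷ʳ b       ≡⟨ cong (λ t → b ∷ t ∷ʳ b) pal ⟩
      b ∷ r ∷ʳ b               ∎
    where open ≡-Reasoning

module _ {A : Set} where

  lookupOr : A → List A → ℕ → A
  lookupOr d []      _       = d
  lookupOr d (c ∷ l) zero    = c
  lookupOr d (c ∷ l) (suc k) = lookupOr d l k

  lookupOr-++ˡ : ∀ d (l r : List A) {k} → k < length l → lookupOr d (l ++ r) k ≡ lookupOr d l k
  lookupOr-++ˡ d (c ∷ l) r {zero}  _         = refl
  lookupOr-++ˡ d (c ∷ l) r {suc k} (s≤s k<) = lookupOr-++ˡ d l r k<

  lookupOr-∈ : ∀ d (l : List A) {k} → k < length l → lookupOr d l k ∈ l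
  lookupOr-∈ d (c ∷ l) {zero}  _         = here refl
  lookupOr-∈ d (c ∷ l) {suc k} (s≤s k<) = there (lookupOr-∈ d l k<)

  applyUpTo-lookupOr : ∀ d (l : List A) n → n ≤ length l → applyUpTo (lookupOr d l) n ≡ take n l
  applyUpTo-lookupOr d l       zero    _         = refl
  applyUpTo-lookupOr d (c ∷ l) (suc n) (s≤s n≤) = cong (c ∷_) (applyUpTo-lookupOr d l n n≤)

  applyUpTo-cong< : ∀ {f g : ℕ → A} n → (∀ {j} → j < n → f j ≡ g j) → applyUpTo f n ≡ applyUpTo g n
  applyUpTo-cong< zero    _    = refl
  applyUpTo-cong< (suc n) f≗g = cong₂ _∷_ (f≗g z<s) (applyUpTo-cong< n (f≗g ∘ s<s))

  applyUpTo-+ : ∀ (f : ℕ → A) m n → applyUpTo f (m + n) ≡ applyUpTo f m ++ applyUpTo (λ j → f (m + j)) n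
  applyUpTo-+ f zero    n = refl
  applyUpTo-+ f (suc m) n = cong (f 0 ∷_) (applyUpTo-+ (f ∘ suc) m n)

  segℕ-applyUpTo : ∀ (z : ℕ → A) i n → segℕ z i n ≡ applyUpTo (λ j → z (i + j)) n
  segℕ-applyUpTo z i = map-upTo (λ j → z (i + j))

module PrefixChainLimit {A : Set} (d : A) (Y : ℕ → List A)
                        (Y-prefix : ∀ m → IsPrefix (Y m) (Y (suc m)))
                        (Y-long : ∀ m → m < length (Y m)) where

  limit : ℕ → A
  limit i = lookupOr d (Y i) i

  Y-mono : ∀ {m m′} → m ≤ m′ → IsPrefix (Y m) (Y m′)
  Y-mono {m} {m′} m≤m′ = subst (IsPrefix (Y m) ∘ Y) (m∸n+n≡m m≤m′) (Y-prefix-+ (m′ ∸ m))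
    where
    Y-prefix-+ : ∀ k → IsPrefix (Y m) (Y (k + m))
    Y-prefix-+ zero    = [] , ++-identityʳ (Y m)
    Y-prefix-+ (suc k) = prefix-trans (Y-prefix-+ k) (Y-prefix (k + m))

  limit-lookup : ∀ {k} m → k < length (Y m) → limit k ≡ lookupOr d (Y m) k
  limit-lookup {k} m k< with ≤-total k m
  ... | inj₁ k≤m with Y-mono k≤m
  ...   | r , eq = trans (sym (lookupOr-++ˡ d (Y k) r (Y-long k))) (cong (λ l → lookupOr d l k) eq)
  limit-lookup {k} m k< | inj₂ m≤k with Y-mono m≤k
  ...   | r , eq = trans (cong (λ l → lookupOr d l k) (sym eq)) (lookupOr-++ˡ d (Y m) r k<)

  limit-prefix : ∀ {n} m → n ≤ length (Y m) → applyUpTo limit n ≡ take n (Y m)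
  limit-prefix {n} m n≤ =
    trans (applyUpTo-cong< n λ j<n → limit-lookup m (<-≤-trans j<n n≤)) (applyUpTo-lookupOr d (Y m) n n≤)

  limit-∈ : ∀ i → limit i ∈ Y i
  limit-∈ i = lookupOr-∈ d (Y i) (Y-long i)

  limit-factor : ∀ u i → segℕ limit i (length u) ≡ u → IsFactor u (Y (i + length u))
  limit-factor u i seg≡u = applyUpTo limit i , rest , (begin
      applyUpTo limit i ++ u ++ rest     ≡⟨ ++-assoc (applyUpTo limit i) u rest ⟨
      (applyUpTo limit i ++ u) ++ rest   ≡⟨ cong (_++ rest) prefix≡ ⟩
      applyUpTo limit M ++ rest          ≡⟨ cong (_++ rest) (limit-prefix M (<⇒≤ (Y-long M))) ⟩
      take M (Y M) ++ drop M (Y M)       ≡⟨ take++drop≡id M (Y M) ⟩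
      Y M                                ∎)
    where
    open ≡-Reasoning
    M = i + length u
    rest = drop M (Y M)
    prefix≡ : applyUpTo limit i ++ u ≡ applyUpTo limit M
    prefix≡ = begin
      applyUpTo limit i ++ u                                          ≡⟨ cong (applyUpTo limit i ++_) seg≡u ⟨
      applyUpTo limit i ++ segℕ limit i (length u)                    ≡⟨ cong (applyUpTo limit i ++_) (segℕ-applyUpTo limit i (length u)) ⟩
      applyUpTo limit i ++ applyUpTo (λ j → limit (i + j)) (length u) ≡⟨ applyUpTo-+ limit i (length u) ⟨
      applyUpTo limit M                                               ∎

module RichWords {A : Set} (_≟_ : DecidableEquality A) where

  private
    ∈-inits⁻ : ∀ (y : List A) {u} → u ∈ inits y → IsPrefix u y
    ∈-inits⁻ []      (here refl) = [] , refl
    ∈-inits⁻ (c ∷ y) (here refl) = c ∷ y , refl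
    ∈-inits⁻ (c ∷ y) (there u∈) with ∈-map⁻ (c ∷_) u∈
    ... | v , v∈ , refl with ∈-inits⁻ y v∈
    ...   | b , refl = b , refl

    ∈-inits⁺ : ∀ (u b : List A) → u ∈ inits (u ++ b)
    ∈-inits⁺ []      []      = here refl
    ∈-inits⁺ []      (_ ∷ _) = here refl
    ∈-inits⁺ (c ∷ u) b       = there (∈-map⁺ (c ∷_) (∈-inits⁺ u b))

  ∈-factors⁻ : ∀ (x : List A) {u} → u ∈ factors _≟_ x → IsFactor u x
  ∈-factors⁻ []      (here refl) = [] , [] , refl
  ∈-factors⁻ (c ∷ x) u∈ with ∈-++⁻ (inits (c ∷ x)) u∈
  ... | inj₁ u∈inits = [] , ∈-inits⁻ (c ∷ x) u∈inits
  ... | inj₂ u∈rest with ∈-factors⁻ x u∈rest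
  ...   | a , b , eq = c ∷ a , b , cong (c ∷_) eq

  ∈-factors⁺ : ∀ (x : List A) {u} → IsFactor u x → u ∈ factors _≟_ x
  ∈-factors⁺ _ {[]}    ([] , [] , refl)     = here refl
  ∈-factors⁺ _ {[]}    ([] , _ ∷ _ , refl)  = here refl
  ∈-factors⁺ _ {_ ∷ _} ([] , b , refl)      = ∈-++⁺ˡ (∈-inits⁺ _ b)
  ∈-factors⁺ _ {u}     (c ∷ a , b , refl)   =
    ∈-++⁺ʳ (inits (c ∷ a ++ u ++ b)) (∈-factors⁺ (a ++ u ++ b) (a , b , refl))

  factor? : ∀ (u x : List A) → Dec (IsFactor u x)
  factor? u x = map′ (∈-factors⁻ x) (∈-factors⁺ x) (DM._∈?_ (≡-dec _≟_) u (factors _≟_ x))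

  palindrome? : Decidable Palindrome
  palindrome? p = ≡-dec _≟_ (reverse p) p

  ∈-Pal⁻ : ∀ (x : List A) {u} → u ∈ Pal _≟_ x → IsFactor u x × Palindrome u
  ∈-Pal⁻ x u∈ with ∈-filter⁻ palindrome? {xs = factors _≟_ x} (∈-deduplicate⁻ (≡-dec _≟_) _ u∈)
  ... | u∈factors , pal = ∈-factors⁻ x u∈factors , pal

  ∈-Pal⁺ : ∀ (x : List A) {u} → IsFactor u x → Palindrome u → u ∈ Pal _≟_ x
  ∈-Pal⁺ x f pal = ∈-deduplicate⁺ (≡-dec _≟_) (∈-filter⁺ palindrome? (∈-factors⁺ x f) pal)

  Pal-unique : ∀ (x : List A) → Unique (Pal _≟_ x)
  Pal-unique x = UDP.deduplicate-! (≡-dec _≟_) (filter palindrome? (factors _≟_ x))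

  #Pal : List A → ℕ
  #Pal x = length (Pal _≟_ x)

  #Pal-mono : ∀ {u x} → IsFactor u x → #Pal u ≤ #Pal x
  #Pal-mono {u} {x} u⊑x = Unique-⊆⇒length≤ (Pal-unique u) λ v∈ →
    let v⊑u , pal = ∈-Pal⁻ u v∈ in ∈-Pal⁺ x (factor-trans v⊑u u⊑x) pal

  #Pal-reverse : ∀ (x : List A) → #Pal (reverse x) ≡ #Pal x
  #Pal-reverse x =
    ≤-antisym (≤ʳ x) (subst (λ t → #Pal t ≤ #Pal (reverse x)) (reverse-involutive x) (≤ʳ (reverse x)))
    where
    ≤ʳ : ∀ (x : List A) → #Pal (reverse x) ≤ #Pal x
    ≤ʳ x = Unique-⊆⇒length≤ (Pal-unique (reverse x)) λ u∈ →
      let u⊑x̃ , pal = ∈-Pal⁻ (reverse x) u∈ in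
      ∈-Pal⁺ x (subst₂ IsFactor pal (reverse-involutive x) (factor-reverse u⊑x̃)) pal

  -- A palindromic suffix is also a prefix, so it reoccurs earlier.
  shorter-palindromic-suffix-old : ∀ {x : List A} {c} a d {v} → Palindrome (d ++ v) → Palindrome v →
    a ++ d ++ v ≡ x ∷ʳ c → d ≢ [] → IsFactor v x
  shorter-palindromic-suffix-old a d {v} pal-dv pal-v eq d≢[] =
    factor-∷ʳ⁻ a (reverse d) (trans (cong (a ++_) (sym (palindromic-suffix-is-prefix d pal-dv pal-v))) eq)
      (d≢[] ∘ reverse-injective)

  new-palindromes-equal : ∀ {x : List A} {c u v} → Palindrome u → Palindrome v →
    IsFactor u (x ∷ʳ c) → IsFactor v (x ∷ʳ c) → ¬ IsFactor u x → ¬ IsFactor v x → u ≡ v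
  new-palindromes-equal {u = u} {v} pal-u pal-v u⊑ v⊑ u-new v-new
    with newFactor⇒suffix u⊑ u-new | newFactor⇒suffix v⊑ v-new
  ... | a , au≡ | b , bv≡ with ++-equidivisible a u b v (trans au≡ (sym bv≡))
  ...   | inj₁ ([] , _ , u≡v) = u≡v
  ...   | inj₁ (d@(_ ∷ _) , _ , refl) = ⊥-elim (v-new (shorter-palindromic-suffix-old a d pal-u pal-v au≡ λ ()))
  ...   | inj₂ ([] , _ , v≡u) = sym v≡u
  ...   | inj₂ (d@(_ ∷ _) , _ , refl) = ⊥-elim (u-new (shorter-palindromic-suffix-old b d pal-v pal-u bv≡ λ ()))

  #Pal-∷ʳ-≤ : ∀ (x : List A) c → #Pal (x ∷ʳ c) ≤ suc (#Pal x)
  #Pal-∷ʳ-≤ x c = begin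
      #Pal (x ∷ʳ c)                 ≤⟨ Unique-⊆⇒length≤ (Pal-unique (x ∷ʳ c)) Pal-∷ʳ⊆ ⟩
      length (new ++ Pal _≟_ x)     ≡⟨ length-++ new ⟩
      length new + #Pal x           ≤⟨ +-monoˡ-≤ (#Pal x) #new≤1 ⟩
      suc (#Pal x)                  ∎
    where
    open ≤-Reasoning
    old? = λ u → factor? u x
    new = filter (¬? ∘ old?) (Pal _≟_ (x ∷ʳ c))
    #new≤1 : length new ≤ 1
    #new≤1 = Unique-constant⇒length≤1 (UP.filter⁺ (¬? ∘ old?) (Pal-unique (x ∷ʳ c))) λ u∈ v∈ →
      let u∈Pal , u-new = ∈-filter⁻ (¬? ∘ old?) {xs = Pal _≟_ (x ∷ʳ c)} u∈
          v∈Pal , v-new = ∈-filter⁻ (¬? ∘ old?) {xs = Pal _≟_ (x ∷ʳ c)} v∈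
          u⊑ , pal-u = ∈-Pal⁻ (x ∷ʳ c) u∈Pal
          v⊑ , pal-v = ∈-Pal⁻ (x ∷ʳ c) v∈Pal
      in new-palindromes-equal pal-u pal-v u⊑ v⊑ u-new v-new
    Pal-∷ʳ⊆ : Pal _≟_ (x ∷ʳ c) ⊆ new ++ Pal _≟_ x
    Pal-∷ʳ⊆ {u} u∈ with old? u
    ... | yes u⊑x = ∈-++⁺ʳ new (∈-Pal⁺ x u⊑x (proj₂ (∈-Pal⁻ (x ∷ʳ c) u∈)))
    ... | no  u-new = ∈-++⁺ˡ (∈-filter⁺ (¬? ∘ old?) u∈ u-new)

  #Pal-∷-≤ : ∀ c (x : List A) → #Pal (c ∷ x) ≤ suc (#Pal x)
  #Pal-∷-≤ c x = begin
      #Pal (c ∷ x)               ≡⟨ #Pal-reverse (c ∷ x) ⟨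
      #Pal (reverse (c ∷ x))     ≡⟨ cong #Pal (unfold-reverse c x) ⟩
      #Pal (reverse x ∷ʳ c)      ≤⟨ #Pal-∷ʳ-≤ (reverse x) c ⟩
      suc (#Pal (reverse x))     ≡⟨ cong suc (#Pal-reverse x) ⟩
      suc (#Pal x)               ∎
    where open ≤-Reasoning

  #Pal≤suc-length : ∀ (x : List A) → #Pal x ≤ suc (length x)
  #Pal≤suc-length []      = ≤-refl
  #Pal≤suc-length (c ∷ x) = ≤-trans (#Pal-∷-≤ c x) (s≤s (#Pal≤suc-length x))

  #Pal-++-≤ˡ : ∀ (a y : List A) → #Pal (a ++ y) ≤ length a + #Pal y
  #Pal-++-≤ˡ []      y = ≤-refl
  #Pal-++-≤ˡ (c ∷ a) y = ≤-trans (#Pal-∷-≤ c (a ++ y)) (s≤s (#Pal-++-≤ˡ a y))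

  #Pal-++-≤ʳ : ∀ (y b : List A) → #Pal (y ++ b) ≤ #Pal y + length b
  #Pal-++-≤ʳ y b = begin
      #Pal (y ++ b)                          ≡⟨ #Pal-reverse (y ++ b) ⟨
      #Pal (reverse (y ++ b))                ≡⟨ cong #Pal (reverse-++ y b) ⟩
      #Pal (reverse b ++ reverse y)          ≤⟨ #Pal-++-≤ˡ (reverse b) (reverse y) ⟩
      length (reverse b) + #Pal (reverse y)  ≡⟨ cong₂ _+_ (length-reverse b) (#Pal-reverse y) ⟩
      length b + #Pal y                      ≡⟨ +-comm (length b) (#Pal y) ⟩
      #Pal y + length b                      ∎
    where open ≤-Reasoning

  Rich-prefix : ∀ (x y : List A) → Rich _≟_ (x ++ y) → Rich _≟_ x
  Rich-prefix x y rich = ≤-antisym (#Pal≤suc-length x) (+-cancelʳ-≤ (length y) _ _ (begin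
      suc (length x) + length y   ≡⟨ cong suc (length-++ x) ⟨
      suc (length (x ++ y))       ≡⟨ rich ⟨
      #Pal (x ++ y)               ≤⟨ #Pal-++-≤ʳ x y ⟩
      #Pal x + length y           ∎))
    where open ≤-Reasoning

  Rich-∷ʳ⇒new-palindromic-suffix : ∀ x c → Rich _≟_ (x ∷ʳ c) →
    ∃ λ r → Palindrome r × IsSuffix r (x ∷ʳ c) × ¬ IsFactor r x
  Rich-∷ʳ⇒new-palindromic-suffix x c rich with any? (λ u → ¬? (factor? u x)) (Pal _≟_ (x ∷ʳ c))
  ... | yes some-new =
    let r , r∈ , r-new = find some-new
        r⊑ , pal = ∈-Pal⁻ (x ∷ʳ c) r∈
    in r , pal , newFactor⇒suffix r⊑ r-new , r-new
  ... | no none-new = ⊥-elim (<-irrefl refl (begin-strict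
      #Pal x                  ≤⟨ #Pal≤suc-length x ⟩
      suc (length x)          <⟨ n<1+n _ ⟩
      suc (suc (length x))    ≡⟨ cong suc (length-∷ʳ x c) ⟨
      suc (length (x ∷ʳ c))   ≡⟨ rich ⟨
      #Pal (x ∷ʳ c)           ≤⟨ Unique-⊆⇒length≤ (Pal-unique (x ∷ʳ c)) all-old ⟩
      #Pal x                  ∎))
    where
    open ≤-Reasoning
    all-old : Pal _≟_ (x ∷ʳ c) ⊆ Pal _≟_ x
    all-old {u} u∈ with factor? u x
    ... | yes u⊑x = ∈-Pal⁺ x u⊑x (proj₂ (∈-Pal⁻ (x ∷ʳ c) u∈))
    ... | no  u-new = ⊥-elim (none-new (lose u∈ u-new))

  new-palindromic-suffix⇒Rich-∷ʳ : ∀ {x c r} → Rich _≟_ x → Palindrome r →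
    IsSuffix r (x ∷ʳ c) → ¬ IsFactor r x → Rich _≟_ (x ∷ʳ c)
  new-palindromic-suffix⇒Rich-∷ʳ {x} {c} {r} rich pal r-suffix r-new =
    ≤-antisym (#Pal≤suc-length (x ∷ʳ c)) (begin
      suc (length (x ∷ʳ c))     ≡⟨ cong suc (length-∷ʳ x c) ⟩
      suc (suc (length x))      ≡⟨ cong suc rich ⟨
      length (r ∷ Pal _≟_ x)    ≤⟨ Unique-⊆⇒length≤ r∷Pal-unique r∷Pal⊆ ⟩
      #Pal (x ∷ʳ c)             ∎)
    where
    open ≤-Reasoning
    r∉Pal : ∀ {u} → u ∈ Pal _≟_ x → r ≢ u
    r∉Pal u∈ refl = r-new (proj₁ (∈-Pal⁻ x u∈))
    r∷Pal-unique : Unique (r ∷ Pal _≟_ x)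
    r∷Pal-unique = All.tabulate r∉Pal ∷ Pal-unique x
    r∷Pal⊆ : r ∷ Pal _≟_ x ⊆ Pal _≟_ (x ∷ʳ c)
    r∷Pal⊆ (here refl) = ∈-Pal⁺ (x ∷ʳ c) (suffix⇒factor r-suffix) pal
    r∷Pal⊆ (there u∈)  = let u⊑x , pal-u = ∈-Pal⁻ x u∈ in
      ∈-Pal⁺ (x ∷ʳ c) (factor-++ʳ [ c ] u⊑x) pal-u

  Rich-singleton : ∀ c → Rich _≟_ [ c ]
  Rich-singleton c = new-palindromic-suffix⇒Rich-∷ʳ {[]} refl refl ([] , refl)
    λ { ([] , _ , ()) ; (_ ∷ _ , _ , ()) }

  Dfin-reverse : ∀ u → Dfin _≟_ (reverse u) ≡ Dfin _≟_ u
  Dfin-reverse u = cong₂ (λ m n → suc m ∸ n) (length-reverse u) (#Pal-reverse u)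

  Rich⇒unioccurrent-palindromic-suffix : ∀ {y} → y ≢ [] → Rich _≟_ y →
    ∃ λ r → Palindrome r × IsSuffix r y × OccursOnlyAsSuffix r y
  Rich⇒unioccurrent-palindromic-suffix {y} y≢[] rich with initLast y
  ... | []       = ⊥-elim (y≢[] refl)
  ... | y′ ∷ʳ′ c with Rich-∷ʳ⇒new-palindromic-suffix y′ c rich
  ...   | r , pal , r-suffix , r-new = r , pal , r-suffix , once
    where
    once : OccursOnlyAsSuffix r (y′ ∷ʳ c)
    once a []      _   = refl
    once a (e ∷ b) occ = ⊥-elim (r-new (factor-∷ʳ⁻ a (e ∷ b) occ λ ()))

  wrapped-occurrence : ∀ a b {r e x : List A} → a ++ (b ∷ r ∷ʳ b) ++ e ≡ x → (a ∷ʳ b) ++ r ++ b ∷ e ≡ x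
  wrapped-occurrence a b {r} {e} occ = begin
      (a ∷ʳ b) ++ r ++ b ∷ e        ≡⟨ ++-assoc a [ b ] (r ++ b ∷ e) ⟩
      a ++ b ∷ r ++ b ∷ e           ≡⟨ cong (λ t → a ++ b ∷ t) (++-assoc r [ b ] e) ⟨
      a ++ (b ∷ r ∷ʳ b) ++ e        ≡⟨ occ ⟩
      _                             ∎
    where open ≡-Reasoning

  RichlyExtendable : List A → Set
  RichlyExtendable x = ∃ λ c → c ∈ x × Rich _≟_ (x ∷ʳ c)

  -- b r b is a new palindromic suffix of x b: an earlier occurrence would put r strictly inside x.
  extend-by-wrap : ∀ {x} a {r} → Rich _≟_ x → a ++ r ≡ x → a ≢ [] → Palindrome r →
    (∀ a₁ b₁ → a₁ ++ r ++ b₁ ≡ x → a₁ ≢ [] → b₁ ≢ [] → ⊥) → RichlyExtendable x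
  extend-by-wrap {x} a {r} rich ar≡x a≢[] pal never-inside with initLast a
  ... | []       = ⊥-elim (a≢[] refl)
  ... | v ∷ʳ′ b  = b , subst (b ∈_) ar≡x (∈-++⁺ˡ (∈-++⁺ʳ v (here refl))) ,
    new-palindromic-suffix⇒Rich-∷ʳ rich (palindrome-wrap b pal) (v , suffix) brb-new
    where
    open ≡-Reasoning
    suffix : v ++ b ∷ r ∷ʳ b ≡ x ∷ʳ b
    suffix = begin
      v ++ (b ∷ r) ∷ʳ b       ≡⟨ ++-assoc v (b ∷ r) [ b ] ⟨
      (v ++ b ∷ r) ∷ʳ b       ≡⟨ cong (_∷ʳ b) (++-assoc v [ b ] r) ⟨
      ((v ∷ʳ b) ++ r) ∷ʳ b    ≡⟨ cong (_∷ʳ b) ar≡x ⟩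
      x ∷ʳ b                  ∎
    brb-new : ¬ IsFactor (b ∷ r ∷ʳ b) x
    brb-new (a₁ , b₁ , occ) =
      never-inside (a₁ ∷ʳ b) (b ∷ b₁) (wrapped-occurrence a₁ b occ) ((λ ()) ∘ ++-conicalʳ a₁ [ b ]) (λ ())

  record LongestProperPalindromicSuffix (x q : List A) : Set where
    field
      palindrome  : Palindrome q
      prefix      : List A
      prefix≢[]   : prefix ≢ []
      prefix++q≡x : prefix ++ q ≡ x
      longest     : ∀ v {q′} → v ≢ [] → v ++ q′ ≡ x → Palindrome q′ → length q′ ≤ length q

  longest-proper-palindromic-suffix : ∀ {x} → x ≢ [] → ∃ (LongestProperPalindromicSuffix x)
  longest-proper-palindromic-suffix {[]} x≢[] = ⊥-elim (x≢[] refl)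
  longest-proper-palindromic-suffix {c ∷ x} _
    with least-witness {P = λ j → Palindrome (drop j x)} (palindrome? ∘ flip drop x) {length x}
                       (subst Palindrome (sym (drop-all (length x) x ≤-refl)) refl)
  ... | k , pal , shorter = drop k x , record
    { palindrome  = pal
    ; prefix      = c ∷ take k x
    ; prefix≢[]   = λ ()
    ; prefix++q≡x = cong (c ∷_) (take++drop≡id k x)
    ; longest     = longest
    }
    where
    longest : ∀ v {q′} → v ≢ [] → v ++ q′ ≡ c ∷ x → Palindrome q′ → length q′ ≤ length (drop k x)
    longest []      v≢[] _  _    = ⊥-elim (v≢[] refl)
    longest (_ ∷ v) {q′} _ eq pal′ = begin
        length q′                   ≡⟨ cong length q′≡ ⟩
        length (drop (length v) x)  ≡⟨ length-drop (length v) x ⟩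
        length x ∸ length v         ≤⟨ ∸-monoʳ-≤ (length x) k≤v ⟩
        length x ∸ k                ≡⟨ length-drop k x ⟨
        length (drop k x)           ∎
      where
      open ≤-Reasoning
      q′≡ : q′ ≡ drop (length v) x
      q′≡ = trans (sym (drop-length-++ v q′)) (cong (drop (length v)) (∷-injectiveʳ eq))
      k≤v : k ≤ length v
      k≤v = ≮⇒≥ λ v<k → shorter {length v} v<k (subst Palindrome q′≡ pal′)

  module _ {x q : List A} (rich : Rich _≟_ x) (pal-x : Palindrome x)
           (lpps : LongestProperPalindromicSuffix x q) where

    open LongestProperPalindromicSuffix lpps

    InnerOccurrence : List A → List A → Set
    InnerOccurrence a b = a ++ q ++ b ≡ x × a ≢ [] × b ≢ []

    q-prefix : IsPrefix q x
    q-prefix = reverse prefix ,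
      trans (sym (palindromic-suffix-is-prefix prefix (subst Palindrome (sym prefix++q≡x) pal-x) palindrome)) prefix++q≡x

    -- Let r be the unioccurrent palindromic suffix of the rich prefix y = a q. As q also starts y,
    -- r is not a suffix of q; r is not y itself, or y would be a palindromic suffix of x longer than q;
    -- so r = d q with a = a′ d, and the prefix q of r is an earlier inner occurrence.
    earlier-inner-occurrence : ∀ {a b} → InnerOccurrence a b →
      ∃₂ λ a′ b′ → length a′ < length a × InnerOccurrence a′ b′
    earlier-inner-occurrence {a} {b} (occ , a≢[] , b≢[]) =
      from-suffix (Rich⇒unioccurrent-palindromic-suffix (a≢[] ∘ ++-conicalˡ a q) rich-y)
      where
      open ≡-Reasoning
      y = a ++ q
      y++b≡x : y ++ b ≡ x
      y++b≡x = trans (++-assoc a q b) occ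
      rich-y : Rich _≟_ y
      rich-y = Rich-prefix y b (subst (Rich _≟_) (sym y++b≡x) rich)
      q<y : length q < length y
      q<y = length-++-<ʳ q a≢[]

      y-not-palindrome : ¬ Palindrome y
      y-not-palindrome pal-y = <⇒≱ q<y (longest (reverse b) (b≢[] ∘ reverse-injective) suffix pal-y)
        where
        suffix : reverse b ++ y ≡ x
        suffix = trans (sym (palindromic-prefix-is-suffix b (subst Palindrome (sym y++b≡x) pal-x) pal-y)) y++b≡x

      suffix-of-q-reoccurs : ∀ {r} d → Palindrome r → q ≡ d ++ r →
        ¬ OccursOnlyAsSuffix r y
      suffix-of-q-reoccurs {r} d pal-r q≡dr once with shorter-prefix q-prefix (b , y++b≡x) q<y
      ... | e , y≡qe , e≢[] = e≢[] (++-conicalʳ (reverse d) e (once [] (reverse d ++ e) (begin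
          r ++ reverse d ++ e      ≡⟨ ++-assoc r (reverse d) e ⟨
          (r ++ reverse d) ++ e    ≡⟨ cong (_++ e) q≡rd ⟨
          q ++ e                   ≡⟨ y≡qe ⟨
          y                        ∎)))
        where
        q≡rd : q ≡ r ++ reverse d
        q≡rd = trans q≡dr (palindromic-suffix-is-prefix d (subst Palindrome q≡dr palindrome) pal-r)

      from-suffix : (∃ λ r → Palindrome r × IsSuffix r y × OccursOnlyAsSuffix r y) →
        ∃₂ λ a′ b′ → length a′ < length a × InnerOccurrence a′ b′
      from-suffix (r , pal-r , (a′ , a′r≡y) , once) with ++-equidivisible a′ r a q a′r≡y
      ... | inj₂ (d , _ , q≡dr)        = ⊥-elim (suffix-of-q-reoccurs d pal-r q≡dr once)
      ... | inj₁ ([] , _ , r≡q)        = ⊥-elim (suffix-of-q-reoccurs [] pal-r (sym r≡q) once)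
      ... | inj₁ (d@(_ ∷ _) , a≡a′d , r≡dq) with a′
      ...   | []      = ⊥-elim (y-not-palindrome (subst Palindrome a′r≡y pal-r))
      ...   | a′@(_ ∷ _) = a′ , reverse d ++ b , a′<a , earlier , (λ ()) , b≢[] ∘ ++-conicalʳ (reverse d) b
        where
        a′<a : length a′ < length a
        a′<a = subst (λ z → length a′ < length z) (sym a≡a′d) (length-++-<ˡ a′ λ ())
        r≡qd : r ≡ q ++ reverse d
        r≡qd = trans r≡dq (palindromic-suffix-is-prefix d (subst Palindrome r≡dq pal-r) palindrome)
        earlier : a′ ++ q ++ reverse d ++ b ≡ x
        earlier = begin
          a′ ++ q ++ reverse d ++ b      ≡⟨ cong (a′ ++_) (++-assoc q (reverse d) b) ⟨
          a′ ++ (q ++ reverse d) ++ b    ≡⟨ cong (λ t → a′ ++ t ++ b) r≡qd ⟨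
          a′ ++ r ++ b                   ≡⟨ ++-assoc a′ r b ⟨
          (a′ ++ r) ++ b                 ≡⟨ cong (_++ b) a′r≡y ⟩
          y ++ b                         ≡⟨ y++b≡x ⟩
          x                              ∎

    no-inner-occurrence : ∀ {a b} → ¬ InnerOccurrence a b
    no-inner-occurrence {a} = go (<-wellFounded (length a))
      where
      go : ∀ {a b} → Acc _<_ (length a) → ¬ InnerOccurrence a b
      go (acc smaller) inner with earlier-inner-occurrence inner
      ... | _ , _ , a′<a , inner′ = go (smaller a′<a) inner′

  Rich-palindrome-extend : ∀ {x} → x ≢ [] → Rich _≟_ x → Palindrome x → RichlyExtendable x
  Rich-palindrome-extend x≢[] rich pal with longest-proper-palindromic-suffix x≢[]
  ... | _ , lpps = extend-by-wrap prefix rich prefix++q≡x prefix≢[] palindrome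
                     λ a b occ a≢[] b≢[] → no-inner-occurrence rich pal lpps (occ , a≢[] , b≢[])
    where open LongestProperPalindromicSuffix lpps

  Rich-extend : ∀ {x} → x ≢ [] → Rich _≟_ x → RichlyExtendable x
  Rich-extend x≢[] rich with Rich⇒unioccurrent-palindromic-suffix x≢[] rich
  ... | r , pal , ([] , refl) , _  = Rich-palindrome-extend x≢[] rich pal
  ... | r , pal , (a@(_ ∷ _) , ar≡x) , once =
    extend-by-wrap a rich ar≡x (λ ()) pal λ a₁ b₁ occ _ b₁≢[] → b₁≢[] (once a₁ b₁ occ)

module InfiniteDefect {A : Set} (_≟_ : DecidableEquality A) where

  open RichWords _≟_

  #Pal-factor-≤ : ∀ (a u b : List A) → #Pal (a ++ u ++ b) ≤ length a + (#Pal u + length b)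
  #Pal-factor-≤ a u b = ≤-trans (#Pal-++-≤ˡ a (u ++ b)) (+-monoʳ-≤ (length a) (#Pal-++-≤ʳ u b))

  -- The rich word x contributes |x| + 1 palindromes to t x, while the letters of t x outside
  -- a factor u contribute at most one new palindrome each.
  Dfin-factor-≤ : ∀ {u x} t → Rich _≟_ x → IsFactor u (t ++ x) → Dfin _≟_ u ≤ length t
  Dfin-factor-≤ {u} {x} t rich (a , b , occ) = m≤n+o⇒m∸n≤o (suc (length u)) (#Pal u)
    (+-cancelʳ-≤ (length a + length b) _ _ (begin
      suc (length u) + (length a + length b)      ≡⟨ cong suc (swap (length u) (length a) (length b)) ⟩
      suc (length a + (length u + length b))      ≡⟨ cong suc length-aub ⟨
      suc (length (a ++ u ++ b))                  ≡⟨ cong (suc ∘ length) occ ⟩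
      suc (length (t ++ x))                       ≡⟨ cong suc (length-++ t) ⟩
      suc (length t + length x)                   ≡⟨ +-suc (length t) (length x) ⟨
      length t + suc (length x)                   ≡⟨ cong (length t +_) rich ⟨
      length t + #Pal x                           ≤⟨ +-monoʳ-≤ (length t) (#Pal-mono (suffix⇒factor (t , refl))) ⟩
      length t + #Pal (t ++ x)                    ≡⟨ cong (λ y → length t + #Pal y) occ ⟨
      length t + #Pal (a ++ u ++ b)               ≤⟨ +-monoʳ-≤ (length t) (#Pal-factor-≤ a u b) ⟩
      length t + (length a + (#Pal u + length b)) ≡⟨ regroup (length t) (length a) (#Pal u) (length b) ⟩
      #Pal u + length t + (length a + length b)   ∎))
    where
    open ≤-Reasoning
    length-aub : length (a ++ u ++ b) ≡ length a + (length u + length b)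
    length-aub = trans (length-++ a) (cong (length a +_) (length-++ u))
    swap : ∀ m n o → m + (n + o) ≡ n + (m + o)
    swap = solve-∀
    regroup : ∀ m n o p → m + (n + (o + p)) ≡ o + m + (n + p)
    regroup = solve-∀

  record RichWordOver (W : List A) : Set where
    field
      word     : List A
      nonempty : word ≢ []
      rich     : Rich _≟_ word
      letters  : word ⊆ W

  grow : ∀ {W} → RichWordOver W → RichWordOver W
  grow {W} r with Rich-extend (RichWordOver.nonempty r) (RichWordOver.rich r)
  ... | c , c∈word , rich′ = record
    { word     = word ∷ʳ c
    ; nonempty = (λ ()) ∘ ++-conicalʳ word [ c ]
    ; rich     = rich′
    ; letters  = letters′
    }
    where
    open RichWordOver r
    letters′ : word ∷ʳ c ⊆ W
    letters′ e∈ with ∈-++⁻ word e∈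
    ... | inj₁ e∈word      = letters e∈word
    ... | inj₂ (here refl) = letters c∈word

  AdmissibleRight : List A → ℕ → Set
  AdmissibleRight w k = ∃ λ z → Factor w (right z) × AlphSub (right z) w × DinfWordLe _≟_ (right z) k

  -- z = t s c₀ c₁ …, where every s c₀ … cₘ is rich.
  nonempty-rich-suffix⇒admissible : ∀ t {s} → s ≢ [] → Rich _≟_ s → AdmissibleRight (t ++ s) (length t)
  nonempty-rich-suffix⇒admissible t {[]}    s≢[] _      = ⊥-elim (s≢[] refl)
  nonempty-rich-suffix⇒admissible t {s@(d ∷ _)} s≢[] rich-s =
    limit , (0 , w-prefix) , letters-limit ,
    λ u (i , seg≡u) → Dfin-factor-≤ t (rich (R (i + length u))) (limit-factor u i seg≡u)
    where
    open RichWordOver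
    R : ℕ → RichWordOver s
    R zero    = record { word = s ; nonempty = s≢[] ; rich = rich-s ; letters = λ c∈ → c∈ }
    R (suc m) = grow (R m)

    Y : ℕ → List A
    Y m = t ++ word (R m)

    Y-long : ∀ m → m < length (Y m)
    Y-long m = <-≤-trans (word-long m) (length-++-≤ʳ (word (R m)) {t})
      where
      word-long : ∀ m → m < length (word (R m))
      word-long zero    = z<s
      word-long (suc m) = subst (suc m <_) (sym (length-∷ʳ (word (R m)) _)) (s≤s (word-long m))

    open PrefixChainLimit d Y (λ m → [ _ ] , ++-assoc t (word (R m)) _) Y-long

    w-prefix : segℕ limit 0 (length (t ++ s)) ≡ t ++ s
    w-prefix = trans (segℕ-applyUpTo limit 0 _)
                     (trans (limit-prefix 0 ≤-refl) (take-all (length (t ++ s)) (t ++ s) ≤-refl))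

    letters-limit : AlphSub (right limit) (t ++ s)
    letters-limit a (i , refl) with ∈-++⁻ t (limit-∈ i)
    ... | inj₁ ∈t = ∈-++⁺ˡ ∈t
    ... | inj₂ ∈word = ∈-++⁺ʳ t (letters (R i) ∈word)

  admissible-mono : ∀ {w k k′} → k ≤ k′ → AdmissibleRight w k → AdmissibleRight w k′
  admissible-mono k≤k′ (z , w-factor , letters , D≤k) =
    z , w-factor , letters , λ u u-factor → ≤-trans (D≤k u u-factor) k≤k′

  rich-suffix⇒admissible : ∀ {w} t {s} → w ≢ [] → t ++ s ≡ w → Rich _≟_ s → AdmissibleRight w (length t)
  rich-suffix⇒admissible t {_ ∷ _} _ refl rich-s = nonempty-rich-suffix⇒admissible t (λ ()) rich-s
  rich-suffix⇒admissible {w} t {[]} w≢[] t≡w _ with initLast w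
  ... | []       = ⊥-elim (w≢[] refl)
  ... | w′ ∷ʳ′ c = admissible-mono w′≤t (nonempty-rich-suffix⇒admissible w′ (λ ()) (Rich-singleton c))
    where
    w′≤t : length w′ ≤ length t
    w′≤t = ≤-trans (n≤1+n (length w′))
                   (≤-reflexive (trans (sym (length-∷ʳ w′ c)) (length-∸-suffix t [] t≡w)))

  admissible-reverse⇒DinftyLe : ∀ {w k} → AdmissibleRight (reverse w) k → DinftyLe _≟_ w k
  admissible-reverse⇒DinftyLe {w} {k} (z , (i , seg≡w̃) , letters , D≤k) =
    left z , (i , w-factor) , (λ a a∈z → reverse⁻ (letters a a∈z)) , D≤k′
    where
    w-factor : reverse (segℕ z i (length w)) ≡ w
    w-factor = trans (cong reverse (trans (cong (segℕ z i) (sym (length-reverse w))) seg≡w̃)) (reverse-involutive w)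
    D≤k′ : DinfWordLe _≟_ (left z) k
    D≤k′ u (j , seg≡u) = subst (_≤ k) (Dfin-reverse u) (D≤k (reverse u) (j , ũ-factor))
      where
      ũ-factor : segℕ z j (length (reverse u)) ≡ reverse u
      ũ-factor = trans (cong (segℕ z j) (length-reverse u)) (trans (sym (reverse-involutive _)) (cong reverse seg≡u))

  rich-suffix⇒DinftyLe : ∀ {w} t {s} → w ≢ [] → t ++ s ≡ w → Rich _≟_ s → DinftyLe _≟_ w (length t)
  rich-suffix⇒DinftyLe t w≢[] t++s≡w rich-s with rich-suffix⇒admissible t w≢[] t++s≡w rich-s
  ... | z , admissible = right z , admissible

  rich-prefix⇒DinftyLe : ∀ {w} p {t} → w ≢ [] → p ++ t ≡ w → Rich _≟_ p → DinftyLe _≟_ w (length t)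
  rich-prefix⇒DinftyLe {w} p {t} w≢[] p++t≡w rich-p = subst (DinftyLe _≟_ w) (length-reverse t)
    (admissible-reverse⇒DinftyLe
      (rich-suffix⇒admissible (reverse t) (w≢[] ∘ reverse-injective) t̃++p̃≡w̃ rich-p̃))
    where
    t̃++p̃≡w̃ : reverse t ++ reverse p ≡ reverse w
    t̃++p̃≡w̃ = trans (sym (reverse-++ p t)) (cong reverse p++t≡w)
    rich-p̃ : Rich _≟_ (reverse p)
    rich-p̃ = trans (#Pal-reverse p) (trans rich-p (cong suc (sym (length-reverse p))))

mainTheorem11 : {A : Set} (_≟_ : DecidableEquality A) (w : List A) (n : ℕ)
    → w ≢ []
    → LongestRichSuffixLength _≟_ w n ⊎ LongestRichPrefixLength _≟_ w n
    → DinftyLe _≟_ w (length w ∸ n)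
mainTheorem11 _≟_ w _ w≢[] (inj₁ ((s , (t , t++s≡w) , rich-s , refl) , _)) =
  subst (DinftyLe _≟_ w) (sym (length-∸-suffix t s t++s≡w)) (rich-suffix⇒DinftyLe t w≢[] t++s≡w rich-s)
  where open InfiniteDefect _≟_
mainTheorem11 _≟_ w _ w≢[] (inj₂ ((p , (t , p++t≡w) , rich-p , refl) , _)) =
  subst (DinftyLe _≟_ w) (sym (length-∸-prefix p t p++t≡w)) (rich-prefix⇒DinftyLe p w≢[] p++t≡w rich-p)
  where open InfiniteDefect _≟_
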